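{- $\equiv_{CS}^\Delta$ is a congruence for the throw operator: for every $A\subseteq\Sigma$ and all CSP processes $P_1,P_2,Q_1,Q_2$, if $P_1\equiv_{CS}^\Delta Q_1$ and $P_2\equiv_{CS}^\Delta Q_2$ then $P_1\,\Theta_A\,P_2\equiv_{CS}^\Delta Q_1\,\Theta_A\,Q_2$.
   Context: Fix a set $\Sigma$ of communications and an internal action $\tau\notin\Sigma$; $a$ ranges over $\Sigma$ and $\alpha$ over $\Sigma\cup\{\tau\}$. CSP expressions are generated by $P,Q ::= \mathrm{STOP}\mid \mathrm{div}\mid a\to P\mid P\sqcap Q\mid P\,\Box\,Q\mid P\rhd Q\mid P\,\|_A\,Q\mid P\setminus A\mid f(P)\mid P\,\triangle\,Q\mid P\,\Theta_A\,Q\mid X\mid \mu X.P$, with $A\subseteq\Sigma$, $f:\Sigma\to\Sigma$ (extended by $f(\tau)=\tau$), $X$ a process identifier. A CSP process is an expression in which every occurrence of an identifier $X$ lies within a subexpression $\mu X.P$. Transitions $P\xrightarrow{\alpha}P'$ are the least relations such that: $\mathrm{div}\xrightarrow{\tau}\mathrm{div}$; $(a\to P)\xrightarrow{a}P$; $P\sqcap Q\xrightarrow{\tau}P$, $P\sqcap Q\xrightarrow{\tau}Q$; if $P\xrightarrow{a}P'$ then $P\Box Q\xrightarrow{a}P'$, $Q\Box P\xrightarrow{a}P'$, $P\rhd Q\xrightarrow{a}P'$; if $P\xrightarrow{\tau}P'$ then $P\Box Q\xrightarrow{\tau}P'\Box Q$, $Q\Box P\xrightarrow{\tau}Q\Box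 P'$, $P\rhd Q\xrightarrow{\tau}P'\rhd Q$; $P\rhd Q\xrightarrow{\tau}Q$; if $P\xrightarrow{\alpha}P'$ then $f(P)\xrightarrow{f(\alpha)}f(P')$; if $P\xrightarrow{\alpha}P'$, $\alpha\notin A$, then $P\|_AQ\xrightarrow{\alpha}P'\|_AQ$, $Q\|_AP\xrightarrow{\alpha}Q\|_AP'$, $P\setminus A\xrightarrow{\alpha}P'\setminus A$, $P\Theta_AQ\xrightarrow{\alpha}P'\Theta_AQ$; if $P\xrightarrow{a}P'$, $Q\xrightarrow{a}Q'$, $a\in A$, then $P\|_AQ\xrightarrow{a}P'\|_AQ'$; if $P\xrightarrow{a}P'$, $a\in A$, then $P\setminus A\xrightarrow{\tau}P'\setminus A$ and $P\Theta_AQ\xrightarrow{a}Q$; if $P\xrightarrow{\alpha}P'$ then $P\triangle Q\xrightarrow{\alpha}P'\triangle Q$; if $Q\xrightarrow{\tau}Q'$ then $P\triangle Q\xrightarrow{\tau}P\triangle Q'$; if $Q\xrightarrow{a}Q'$ then $P\triangle Q\xrightarrow{a}Q'$; $\mu X.P\xrightarrow{\tau}P[\mu X.P/X]$. Write $P\Rightarrow Q$ if $P=P_0\xrightarrow{\tau}\cdots\xrightarrow{\tau}P_n=Q$ ($n\ge 0$); $P\overset{\alpha}{\Rightarrow}Q$ if $P\Rightarrow P'\xrightarrow{\alpha}Q'\Rightarrow Q$; $P\overset{\hat\alpha}{\Rightarrow}Q$ means $P\overset{\alpha}{\Rightarrow}Q$ if $\alpha\in\Sigma$ and $P\Rightarrow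 Q$ if $\alpha=\tau$. $P{\Uparrow}$ ($P$ diverges) if there are $P_0,P_1,\dots$ with $P\Rightarrow P_0\xrightarrow{\tau}P_1\xrightarrow{\tau}\cdots$. A coupled simulation is a relation $\mathcal R$ on CSP processes such that (i) if $P\mathcal RQ$ and $P\xrightarrow{\alpha}P'$ then $Q\overset{\hat\alpha}{\Rightarrow}Q'$ with $P'\mathcal RQ'$ for some $Q'$, and (ii) if $P\mathcal RQ$ then $Q\Rightarrow Q'$ with $Q'\mathcal RP$ for some $Q'$; it is divergence-preserving if $P\mathcal RQ$ and $P{\Uparrow}$ imply $Q{\Uparrow}$. $P\sqsupseteq_{CS}^\Delta Q$ (also written $Q\sqsubseteq_{CS}^\Delta P$) iff $P\mathcal RQ$ for some divergence-preserving coupled simulation $\mathcal R$; $P\equiv_{CS}^\Delta Q$ iff $P\sqsupseteq_{CS}^\Delta Q$ and $Q\sqsupseteq_{CS}^\Delta P$. -}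

module Defs where

open import Data.Nat using (ℕ; suc)
open import Data.Nat.Properties using (_≟_)
open import Data.List using (List; []; _∷_)
open import Data.List.Membership.Propositional using (_∈_)
open import Data.Product using (Σ; ∃; _×_; _,_)
open import Data.Unit using (⊤)
open import Relation.Nullary using (¬_; yes; no)
open import Relation.Binary.Construct.Closure.ReflexiveTransitive using (Star)
open import Level using (Level; suc; _⊔_) renaming (zero to lzero)

Ident : Set
Ident = ℕ

-- CSP expressions over an alphabet Sig of communications.
-- Subsets A ⊆ Sig are predicates Sig → Set.
data Expr (Sig : Set) : Set₁ where
  STOP    : Expr Sig
  div     : Expr Sig
  _⟶_     : Sig → Expr Sig → Expr Sig
  _⊓_     : Expr Sig → Expr Sig → Expr Sig
  _□_     : Expr Sig → Expr Sig → Expr Sig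
  _▷_     : Expr Sig → Expr Sig → Expr Sig
  par     : Expr Sig → (Sig → Set) → Expr Sig → Expr Sig
  hide    : Expr Sig → (Sig → Set) → Expr Sig
  ren     : (Sig → Sig) → Expr Sig → Expr Sig
  _△_     : Expr Sig → Expr Sig → Expr Sig
  throw   : Expr Sig → (Sig → Set) → Expr Sig → Expr Sig
  var     : Ident → Expr Sig
  μ       : Ident → Expr Sig → Expr Sig

data WS {Sig : Set} (Γ : List Ident) : Expr Sig → Set₁ where
  STOP  : WS Γ STOP
  div   : WS Γ div
  pre   : ∀ {a P} → WS Γ P → WS Γ (a ⟶ P)
  ⊓ws   : ∀ {P Q} → WS Γ P → WS Γ Q → WS Γ (P ⊓ Q)
  □ws   : ∀ {P Q} → WS Γ P → WS Γ Q → WS Γ (P □ Q)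
  ▷ws   : ∀ {P Q} → WS Γ P → WS Γ Q → WS Γ (P ▷ Q)
  parws : ∀ {P A Q} → WS Γ P → WS Γ Q → WS Γ (par P A Q)
  hidews : ∀ {P A} → WS Γ P → WS Γ (hide P A)
  renws : ∀ {f P} → WS Γ P → WS Γ (ren f P)
  △ws   : ∀ {P Q} → WS Γ P → WS Γ Q → WS Γ (P △ Q)
  throwws : ∀ {P A Q} → WS Γ P → WS Γ Q → WS Γ (throw P A Q)
  varws : ∀ {X} → X ∈ Γ → WS Γ (var X)
  μws   : ∀ {X P} → WS (X ∷ Γ) P → WS Γ (μ X P)

IsProcess : {Sig : Set} → Expr Sig → Set₁
IsProcess P = WS [] P

-- Substitution P[Q/X] (only ever used with Q closed, so no capture).
_[_/_] : {Sig : Set} → Expr Sig → Expr Sig → Ident → Expr Sig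
STOP [ R / X ] = STOP
div [ R / X ] = div
(a ⟶ P) [ R / X ] = a ⟶ (P [ R / X ])
(P ⊓ Q) [ R / X ] = (P [ R / X ]) ⊓ (Q [ R / X ])
(P □ Q) [ R / X ] = (P [ R / X ]) □ (Q [ R / X ])
(P ▷ Q) [ R / X ] = (P [ R / X ]) ▷ (Q [ R / X ])
par P A Q [ R / X ] = par (P [ R / X ]) A (Q [ R / X ])
hide P A [ R / X ] = hide (P [ R / X ]) A
ren f P [ R / X ] = ren f (P [ R / X ])
(P △ Q) [ R / X ] = (P [ R / X ]) △ (Q [ R / X ])
throw P A Q [ R / X ] = throw (P [ R / X ]) A (Q [ R / X ])
var Y [ R / X ] with X ≟ Y
... | yes _ = R
... | no _ = var Y
μ Y P [ R / X ] with X ≟ Y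
... | yes _ = μ Y P
... | no _ = μ Y (P [ R / X ])

data Act (Sig : Set) : Set where
  τ  : Act Sig
  ev : Sig → Act Sig

renAct : {Sig : Set} → (Sig → Sig) → Act Sig → Act Sig
renAct f τ = τ
renAct f (ev a) = ev (f a)

-- α ∉ A  (τ is never in A ⊆ Sig)
NotIn : {Sig : Set} → Act Sig → (Sig → Set) → Set
NotIn τ A = ⊤
NotIn (ev a) A = ¬ A a

data _—[_]→_ {Sig : Set} : Expr Sig → Act Sig → Expr Sig → Set₁ where
  div-τ   : div —[ τ ]→ div
  pre-a   : ∀ {a P} → (a ⟶ P) —[ ev a ]→ P
  ⊓-l     : ∀ {P Q} → (P ⊓ Q) —[ τ ]→ P
  ⊓-r     : ∀ {P Q} → (P ⊓ Q) —[ τ ]→ Q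
  □-l-a   : ∀ {P P' Q a} → P —[ ev a ]→ P' → (P □ Q) —[ ev a ]→ P'
  □-r-a   : ∀ {P P' Q a} → P —[ ev a ]→ P' → (Q □ P) —[ ev a ]→ P'
  ▷-a     : ∀ {P P' Q a} → P —[ ev a ]→ P' → (P ▷ Q) —[ ev a ]→ P'
  □-l-τ   : ∀ {P P' Q} → P —[ τ ]→ P' → (P □ Q) —[ τ ]→ (P' □ Q)
  □-r-τ   : ∀ {P P' Q} → P —[ τ ]→ P' → (Q □ P) —[ τ ]→ (Q □ P')
  ▷-τ     : ∀ {P P' Q} → P —[ τ ]→ P' → (P ▷ Q) —[ τ ]→ (P' ▷ Q)
  ▷-time  : ∀ {P Q} → (P ▷ Q) —[ τ ]→ Q
  ren-α   : ∀ {f P P' α} → P —[ α ]→ P' → ren f P —[ renAct f α ]→ ren f P'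
  par-l   : ∀ {P P' Q A α} → NotIn α A → P —[ α ]→ P' → par P A Q —[ α ]→ par P' A Q
  par-r   : ∀ {P P' Q A α} → NotIn α A → P —[ α ]→ P' → par Q A P —[ α ]→ par Q A P'
  hide-α  : ∀ {P P' A α} → NotIn α A → P —[ α ]→ P' → hide P A —[ α ]→ hide P' A
  throw-α : ∀ {P P' Q A α} → NotIn α A → P —[ α ]→ P' → throw P A Q —[ α ]→ throw P' A Q
  par-sync : ∀ {P P' Q Q' A a} → P —[ ev a ]→ P' → Q —[ ev a ]→ Q' → A a →
             par P A Q —[ ev a ]→ par P' A Q'
  hide-τ  : ∀ {P P' A a} → P —[ ev a ]→ P' → A a → hide P A —[ τ ]→ hide P' A
  throw-a : ∀ {P P' Q A a} → P —[ ev a ]→ P' → A a → throw P A Q —[ ev a ]→ Q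
  △-l     : ∀ {P P' Q α} → P —[ α ]→ P' → (P △ Q) —[ α ]→ (P' △ Q)
  △-r-τ   : ∀ {P Q Q'} → Q —[ τ ]→ Q' → (P △ Q) —[ τ ]→ (P △ Q')
  △-r-a   : ∀ {P Q Q' a} → Q —[ ev a ]→ Q' → (P △ Q) —[ ev a ]→ Q'
  μ-unf   : ∀ {X P} → μ X P —[ τ ]→ (P [ μ X P / X ])

_⇒_ : {Sig : Set} → Expr Sig → Expr Sig → Set₁
_⇒_ = Star (λ P Q → P —[ τ ]→ Q)

_=[_]⇒_ : {Sig : Set} → Expr Sig → Act Sig → Expr Sig → Set₁
P =[ α ]⇒ Q = Σ _ λ P' → Σ _ λ Q' → (P ⇒ P') × (P' —[ α ]→ Q') × (Q' ⇒ Q)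

_=[_]⇒̂_ : {Sig : Set} → Expr Sig → Act Sig → Expr Sig → Set₁
P =[ τ ]⇒̂ Q = P ⇒ Q
P =[ ev a ]⇒̂ Q = P =[ ev a ]⇒ Q

Diverges : {Sig : Set} → Expr Sig → Set₁
Diverges P = Σ (ℕ → _) λ s → (P ⇒ s 0) × (∀ i → s i —[ τ ]→ s (ℕ.suc i))
  where import Data.Nat as ℕ

Rel : Set → Set₂
Rel Sig = Expr Sig → Expr Sig → Set₁

record CoupledSimulation {Sig : Set} (R : Rel Sig) : Set₁ where
  field
    sim : ∀ {P Q α P'} → R P Q → P —[ α ]→ P' →
          Σ _ λ Q' → (Q =[ α ]⇒̂ Q') × R P' Q'
    coupling : ∀ {P Q} → R P Q → Σ _ λ Q' → (Q ⇒ Q') × R Q' P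

DivergencePreserving : {Sig : Set} → Rel Sig → Set₁
DivergencePreserving R = ∀ {P Q} → R P Q → Diverges P → Diverges Q

_⊒CSΔ_ : {Sig : Set} → Expr Sig → Expr Sig → Set₂
P ⊒CSΔ Q = Σ (Rel _) λ R → CoupledSimulation R × DivergencePreserving R × R P Q

_≡CSΔ_ : {Sig : Set} → Expr Sig → Expr Sig → Set₂
P ≡CSΔ Q = (P ⊒CSΔ Q) × (Q ⊒CSΔ P)

-- A throw context throw □ A X is transparent to the moves of its left argument that
-- avoid A; a move a ∈ A discards the context and continues as X. So pairs
-- (throw P A X, throw Q A Y) with P related to Q, together with the pairs relating the
-- continuations, form a divergence-preserving coupled simulation. Coupling swaps the
-- sides, so X and Y must be related in both directions: the continuations are related
-- by the union of the two simulations witnessing P₂ ⊒ Q₂ and Q₂ ⊒ P₂.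
module Submission where

open import Defs
open import Data.Nat using (suc)
open import Data.Product using (Σ; _×_; _,_; proj₁; proj₂)
open import Data.Sum using (inj₁; inj₂)
open import Data.Unit using (tt)
open import Relation.Binary.PropositionalEquality using (_≡_; refl; subst)
open import Relation.Binary.Construct.Closure.ReflexiveTransitive using (ε; _◅_)
open import Relation.Binary.Construct.Union using (_∪_)

module _ {Sig : Set} where

  ∪-coupledSimulation : {R S : Rel Sig} →
    CoupledSimulation R → CoupledSimulation S → CoupledSimulation (R ∪ S)
  ∪-coupledSimulation {R} {S} csR csS = record { sim = sim ; coupling = coupling }
    where
      module CR = CoupledSimulation csR
      module CS = CoupledSimulation csS

      sim : ∀ {P Q α P'} → (R ∪ S) P Q → P —[ α ]→ P' →
            Σ _ λ Q' → (Q =[ α ]⇒̂ Q') × (R ∪ S) P' Q'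
      sim (inj₁ r) t with CR.sim r t
      ... | Q' , w , r' = Q' , w , inj₁ r'
      sim (inj₂ s) t with CS.sim s t
      ... | Q' , w , s' = Q' , w , inj₂ s'

      coupling : ∀ {P Q} → (R ∪ S) P Q → Σ _ λ Q' → (Q ⇒ Q') × (R ∪ S) Q' P
      coupling (inj₁ r) with CR.coupling r
      ... | Q' , w , r' = Q' , w , inj₁ r'
      coupling (inj₂ s) with CS.coupling s
      ... | Q' , w , s' = Q' , w , inj₂ s'

  ∪-divergencePreserving : {R S : Rel Sig} →
    DivergencePreserving R → DivergencePreserving S → DivergencePreserving (R ∪ S)
  ∪-divergencePreserving dpR dpS (inj₁ r) = dpR r
  ∪-divergencePreserving dpR dpS (inj₂ s) = dpS s

module _ {Sig : Set} (A : Sig → Set) where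

  throw-⇒ : ∀ {P P' X} → P ⇒ P' → throw P A X ⇒ throw P' A X
  throw-⇒ ε = ε
  throw-⇒ (t ◅ ts) = throw-α tt t ◅ throw-⇒ ts

  throw-=⇒̂ : ∀ {P P' X} α → NotIn α A → P =[ α ]⇒̂ P' → throw P A X =[ α ]⇒̂ throw P' A X
  throw-=⇒̂ τ _ w = throw-⇒ w
  throw-=⇒̂ (ev a) a∉A (_ , _ , w₁ , t , w₂) = _ , _ , throw-⇒ w₁ , throw-α a∉A t , throw-⇒ w₂

  -- Junk value STOP off the throw shape; it is only ever applied to throw terms.
  throwLeft : Expr Sig → Expr Sig
  throwLeft (throw P _ _) = P
  throwLeft _ = STOP

  throw-τ-inversion : ∀ {P X R} → throw P A X —[ τ ]→ R →
                      (R ≡ throw (throwLeft R) A X) × (P —[ τ ]→ throwLeft R)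
  throw-τ-inversion (throw-α _ t) = refl , t

  throw-⇒-inversion : ∀ {P X R} → throw P A X ⇒ R →
                      (R ≡ throw (throwLeft R) A X) × (P ⇒ throwLeft R)
  throw-⇒-inversion ε = refl , ε
  throw-⇒-inversion (throw-α _ t ◅ ts) with throw-⇒-inversion ts
  ... | eq , ts' = eq , t ◅ ts'

  throw-diverges : ∀ {P X} → Diverges P → Diverges (throw P A X)
  throw-diverges {X = X} (s , w , t) = (λ i → throw (s i) A X) , throw-⇒ w , λ i → throw-α tt (t i)

  throw-diverges⁻¹ : ∀ {P X} → Diverges (throw P A X) → Diverges P
  throw-diverges⁻¹ {X = X} (s , w , t) =
      (λ i → throwLeft (s i)) , proj₂ (throw-⇒-inversion w) , λ i → proj₂ (stepLeft i)
    where
      shape : ∀ i → s i ≡ throw (throwLeft (s i)) A X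
      stepLeft : ∀ i → (s (suc i) ≡ throw (throwLeft (s (suc i))) A X) ×
                       (throwLeft (s i) —[ τ ]→ throwLeft (s (suc i)))
      shape 0 = proj₁ (throw-⇒-inversion w)
      shape (suc i) = proj₁ (stepLeft i)
      stepLeft i = throw-τ-inversion (subst (λ R → R —[ τ ]→ s (suc i)) (shape i) (t i))

  data ThrowClosure (R S : Rel Sig) : Rel Sig where
    throwing : ∀ {P Q X Y} → R P Q → S X Y → S Y X →
               ThrowClosure R S (throw P A X) (throw Q A Y)
    thrown   : ∀ {X Y} → S X Y → ThrowClosure R S X Y

  throwClosure-coupledSimulation : {R S : Rel Sig} →
    CoupledSimulation R → CoupledSimulation S → CoupledSimulation (ThrowClosure R S)
  throwClosure-coupledSimulation {R} {S} csR csS = record { sim = sim ; coupling = coupling }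
    where
      module CR = CoupledSimulation csR
      module CS = CoupledSimulation csS

      sim : ∀ {P Q α P'} → ThrowClosure R S P Q → P —[ α ]→ P' →
            Σ _ λ Q' → (Q =[ α ]⇒̂ Q') × ThrowClosure R S P' Q'
      sim (thrown s) t with CS.sim s t
      ... | Q' , w , s' = Q' , w , thrown s'
      sim {Q = throw _ _ Y} {α = α} (throwing r sXY sYX) (throw-α α∉A t) with CR.sim r t
      ... | Q' , w , r' = throw Q' A Y , throw-=⇒̂ α α∉A w , throwing r' sXY sYX
      sim {Q = throw _ _ Y} (throwing r sXY _) (throw-a t a∈A) with CR.sim r t
      ... | _ , (_ , _ , w , t' , _) , _ = Y , (_ , _ , throw-⇒ w , throw-a t' a∈A , ε) , thrown sXY

      coupling : ∀ {P Q} → ThrowClosure R S P Q → Σ _ λ Q' → (Q ⇒ Q') × ThrowClosure R S Q' P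
      coupling (thrown s) with CS.coupling s
      ... | Q' , w , s' = Q' , w , thrown s'
      coupling {Q = throw _ _ Y} (throwing r sXY sYX) with CR.coupling r
      ... | Q' , w , r' = throw Q' A Y , throw-⇒ w , throwing r' sYX sXY

  throwClosure-divergencePreserving : {R S : Rel Sig} →
    DivergencePreserving R → DivergencePreserving S → DivergencePreserving (ThrowClosure R S)
  throwClosure-divergencePreserving dpR dpS (throwing r _ _) d = throw-diverges (dpR r (throw-diverges⁻¹ d))
  throwClosure-divergencePreserving dpR dpS (thrown s) d = dpS s d

  throw-mono-⊒CSΔ : ∀ {P₁ P₂ Q₁ Q₂} → P₁ ⊒CSΔ Q₁ → P₂ ⊒CSΔ Q₂ → Q₂ ⊒CSΔ P₂ →
                    throw P₁ A P₂ ⊒CSΔ throw Q₁ A Q₂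
  throw-mono-⊒CSΔ (R , csR , dpR , r) (S , csS , dpS , s) (S' , csS' , dpS' , s') =
      ThrowClosure R (S ∪ S')
    , throwClosure-coupledSimulation csR (∪-coupledSimulation csS csS')
    , throwClosure-divergencePreserving dpR (∪-divergencePreserving dpS dpS')
    , throwing r (inj₁ s) (inj₂ s')

proposition5 : (Sig : Set) (A : Sig → Set) (P₁ P₂ Q₁ Q₂ : Expr Sig) →
               IsProcess P₁ → IsProcess P₂ → IsProcess Q₁ → IsProcess Q₂ →
               P₁ ≡CSΔ Q₁ → P₂ ≡CSΔ Q₂ →
               throw P₁ A P₂ ≡CSΔ throw Q₁ A Q₂
-- The congruence holds for arbitrary expressions.
proposition5 Sig A P₁ P₂ Q₁ Q₂ _ _ _ _ (P₁⊒Q₁ , Q₁⊒P₁) (P₂⊒Q₂ , Q₂⊒P₂) =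
  throw-mono-⊒CSΔ A P₁⊒Q₁ P₂⊒Q₂ Q₂⊒P₂ , throw-mono-⊒CSΔ A Q₁⊒P₁ Q₂⊒P₂ P₂⊒Q₂
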